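{- Let $G=(A,B,E)$ be a bipartite graph, let $S$ be a semi-matching of $G$ that does not admit a degree-minimizing path of length $2$, and let $d=\operatorname{deg}_{\max}S$. Then $S$ can be partitioned into $d$ matchings $M_1,\dots,M_d$ such that for every $i$, $M_i$ is a maximal matching in the subgraph $G|_{A_i\times B_i}$ of $G$ induced by $A_i\cup B_i$, where $A_1=A$, $B_1=B$, and for $i>1$: $A_i=A\setminus\bigcup_{1\le j<i}A(M_j)$ and $B_i=B(M_{i-1})$.
   Context: $\deg_S(v)$ is the number of edges of $S$ at $v$ and $\operatorname{deg}_{\max}S=\max_{v\in A\cup B}\deg_S(v)$. A semi-matching is a set $S\subseteq E$ with $\deg_S(a)=1$ for all $a\in A$. A length-2 degree-minimizing path with respect to $S$ is a path $b_1,a_1,b_2$ with $(a_1,b_1)\in S$, $(a_1,b_2)\in E\setminus S$, and $\deg_S(b_1)\ge\deg_S(b_2)+2$. For $M\subseteq E$, $A(M)$ and $B(M)$ are the sets of $A$-endpoints and $B$-endpoints of edges of $M$. A matching is maximal in a graph if no edge of that graph can be added to it keeping it a matching. -}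

module Defs where

open import Data.Nat using (ℕ; zero; suc; _+_; _≤_; _<_; _⊔_)
open import Data.Fin using (Fin; toℕ)
open import Data.List using (List; foldr; map)
open import Data.Nat.ListAction using (sum)
open import Data.List.Base using (allFin)
open import Data.Bool using (Bool; true; false; if_then_else_)
open import Data.Product using (Σ; ∃; _×_)
open import Data.Sum using (_⊎_)
open import Relation.Nullary using (¬_)
open import Relation.Binary.PropositionalEquality using (_≡_)

-- A bipartite graph G = (A, B, E) with A = Fin m, B = Fin n.
-- An edge set (subset of A × B) is a Boolean-valued relation.
EdgeSet : ℕ → ℕ → Set
EdgeSet m n = Fin m → Fin n → Bool

_⊆E_ : ∀ {m n} → EdgeSet m n → EdgeSet m n → Set
S ⊆E T = ∀ a b → S a b ≡ true → T a b ≡ true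

indicator : Bool → ℕ
indicator true  = 1
indicator false = 0

degA : ∀ {m n} → EdgeSet m n → Fin m → ℕ
degA {m} {n} S a = sum (map (λ b → indicator (S a b)) (allFin n))

degB : ∀ {m n} → EdgeSet m n → Fin n → ℕ
degB {m} {n} S b = sum (map (λ a → indicator (S a b)) (allFin m))

degMax : ∀ {m n} → EdgeSet m n → ℕ
degMax {m} {n} S =
  foldr _⊔_ 0 (map (degA S) (allFin m)) ⊔ foldr _⊔_ 0 (map (degB S) (allFin n))

IsSemiMatching : ∀ {m n} → EdgeSet m n → EdgeSet m n → Set
IsSemiMatching {m} E S = (S ⊆E E) × (∀ (a : Fin m) → degA S a ≡ 1)

DMPath2 : ∀ {m n} → EdgeSet m n → EdgeSet m n → Set
DMPath2 {m} {n} E S =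
  Σ (Fin m) λ a₁ → Σ (Fin n) λ b₁ → Σ (Fin n) λ b₂ →
    (S a₁ b₁ ≡ true) × (E a₁ b₂ ≡ true) × (S a₁ b₂ ≡ false) ×
    (degB S b₂ + 2 ≤ degB S b₁)

IsMatching : ∀ {m n} → EdgeSet m n → Set
IsMatching {m} {n} M = (∀ (a : Fin m) → degA M a ≤ 1) × (∀ (b : Fin n) → degB M b ≤ 1)

InAEnd : ∀ {m n} → EdgeSet m n → Fin m → Set
InAEnd {m} {n} M a = Σ (Fin n) λ b → M a b ≡ true

InBEnd : ∀ {m n} → EdgeSet m n → Fin n → Set
InBEnd {m} {n} M b = Σ (Fin m) λ a → M a b ≡ true

IsMaximalMatchingIn : ∀ {m n} → EdgeSet m n → (Fin m → Set) → (Fin n → Set) →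
                      EdgeSet m n → Set
IsMaximalMatchingIn {m} {n} E X Y M =
  IsMatching M ×
  (∀ a b → M a b ≡ true → (E a b ≡ true) × X a × Y b) ×
  (∀ a b → E a b ≡ true → X a → Y b → InAEnd M a ⊎ InBEnd M b)

-- Indices are 0-based: matching i : Fin d corresponds to M_{i+1} of the paper.
-- A_i = A \ ⋃_{j<i} A(M_j)   (for i = 0 this is all of A)
Aset : ∀ {m n d} → (Fin d → EdgeSet m n) → Fin d → Fin m → Set
Aset {d = d} M i a = ∀ (j : Fin d) → toℕ j < toℕ i → ¬ InAEnd (M j) a

Bset : ∀ {m n d} → (Fin d → EdgeSet m n) → Fin d → Fin n → Set
Bset {d = d} M i b =
  (toℕ i ≡ 0) ⊎ (Σ (Fin d) λ j → (suc (toℕ j) ≡ toℕ i) × InBEnd (M j) b)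

IsPartition : ∀ {m n d} → EdgeSet m n → (Fin d → EdgeSet m n) → Set
IsPartition {m} {n} {d} S M =
  (∀ i → M i ⊆E S) ×
  (∀ a b → S a b ≡ true → Σ (Fin d) λ i → M i a b ≡ true) ×
  (∀ i j a b → M i a b ≡ true → M j a b ≡ true → i ≡ j)

module Submission where

-- At each b ∈ B, number the S-edges (a, b) by the position 0, 1, …, deg_S(b) − 1 of a
-- among the S-neighbours of b, and let M_k consist of the edges numbered k. Each M_k is a
-- matching, and since every a has exactly one S-edge, A_k is the set of a whose edge has
-- number ≥ k, while B_k is the set of b with deg_S(b) ≥ k. Let (a, b) ∈ E with a ∈ A_k.
-- If deg_S(b) > k then b is covered by M_k; if a's edge (a, b′) has number k then a is.
-- Otherwise its number exceeds k ≥ deg_S(b), so deg_S(b′) ≥ deg_S(b) + 2 and b′, a, b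
-- is a degree-minimizing path of length 2.

open import Defs
open import Data.Nat using (ℕ; zero; suc; _+_; _≤_; _<_; _⊔_; _≡ᵇ_; z≤n; s≤s)
open import Data.Nat.Properties
  using ( ≡⇒≡ᵇ; ≡ᵇ⇒≡; 0≢1+n; +-cancelˡ-≡; +-monoʳ-<; +-comm; m≤m⊔n; m≤n⇒m≤o⊔n
        ; ≤-reflexive; ≤-trans; <⇒≤; ≤-<-trans; <-asym; <-irrefl; ≮⇒≥; ≤∧≢⇒<
        ; n<1⇒n≡0; _<?_; _≟_; module ≤-Reasoning )
open import Data.Fin using (Fin; zero; suc; toℕ; fromℕ<)
open import Data.Fin.Properties using (toℕ-fromℕ<; toℕ-injective)
open import Data.List using (_∷_; foldr; map; tabulate; allFin)
open import Data.List.Properties using (map-tabulate)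
open import Data.List.Membership.Propositional using (_∈_)
open import Data.List.Membership.Propositional.Properties using (∈-map⁺; ∈-allFin)
open import Data.List.Relation.Unary.Any using (here; there)
open import Data.Nat.ListAction using (sum)
open import Data.Bool using (Bool; true; false; _∧_)
open import Data.Bool.Properties using (T-≡; ¬-not)
open import Data.Product using (Σ; ∃; _×_; _,_; proj₁; proj₂)
open import Data.Sum using (_⊎_; inj₁; inj₂)
open import Data.Empty using (⊥-elim)
open import Function using (_∘_; id)
open import Function.Bundles using (Equivalence)
open import Relation.Nullary using (¬_; yes; no)
open import Relation.Binary.PropositionalEquality

∈⇒≤-foldr-⊔ : ∀ {x xs} → x ∈ xs → x ≤ foldr _⊔_ 0 xs
∈⇒≤-foldr-⊔ (here refl) = m≤m⊔n _ _
∈⇒≤-foldr-⊔ {xs = y ∷ _} (there x∈xs) = m≤n⇒m≤o⊔n y (∈⇒≤-foldr-⊔ x∈xs)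

count : ∀ {m} → (Fin m → Bool) → ℕ
count {zero}  f = 0
count {suc m} f = indicator (f zero) + count (f ∘ suc)

sum-tabulate-indicator : ∀ {m} (f : Fin m → Bool) →
  sum (tabulate (indicator ∘ f)) ≡ count f
sum-tabulate-indicator {zero}  f = refl
sum-tabulate-indicator {suc m} f =
  cong (indicator (f zero) +_) (sum-tabulate-indicator (f ∘ suc))

sum-allFin-indicator : ∀ {m} (f : Fin m → Bool) →
  sum (map (indicator ∘ f) (allFin m)) ≡ count f
sum-allFin-indicator f =
  trans (cong sum (map-tabulate id (indicator ∘ f))) (sum-tabulate-indicator f)

rank : ∀ {m} → (Fin m → Bool) → Fin m → ℕ
rank f zero    = 0
rank f (suc x) = indicator (f zero) + rank (f ∘ suc) x

rank<count : ∀ {m} (f : Fin m → Bool) x → f x ≡ true → rank f x < count f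
rank<count f zero    fx rewrite fx = s≤s z≤n
rank<count f (suc x) fx = +-monoʳ-< (indicator (f zero)) (rank<count (f ∘ suc) x fx)

rank-injective : ∀ {m} (f : Fin m → Bool) x y → f x ≡ true → f y ≡ true →
  rank f x ≡ rank f y → x ≡ y
rank-injective f zero    zero    _  _  _ = refl
rank-injective f zero    (suc y) fx _  e rewrite fx = ⊥-elim (0≢1+n e)
rank-injective f (suc x) zero    _  fy e rewrite fy = ⊥-elim (0≢1+n (sym e))
rank-injective f (suc x) (suc y) fx fy e =
  cong suc (rank-injective (f ∘ suc) x y fx fy (+-cancelˡ-≡ (indicator (f zero)) _ _ e))

rank-surjective : ∀ {m} (f : Fin m → Bool) k → k < count f →
  Σ (Fin m) λ x → f x ≡ true × rank f x ≡ k
rank-surjective {suc m} f k k<count with f zero in f0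
rank-surjective {suc m} f zero    _               | true = zero , f0 , refl
rank-surjective {suc m} f (suc k) (s≤s k<count)   | true
  with x , fx , r ← rank-surjective (f ∘ suc) k k<count = suc x , fx , cong₂ _+_ (cong indicator f0) r
rank-surjective {suc m} f k       k<count         | false
  with x , fx , r ← rank-surjective (f ∘ suc) k k<count = suc x , fx , cong₂ _+_ (cong indicator f0) r

count≤1⇒unique : ∀ {m} (f : Fin m → Bool) → count f ≤ 1 →
  ∀ x y → f x ≡ true → f y ≡ true → x ≡ y
count≤1⇒unique f c≤1 x y fx fy = rank-injective f x y fx fy (trans (first x fx) (sym (first y fy)))
  where
  first : ∀ z → f z ≡ true → rank f z ≡ 0
  first z fz = n<1⇒n≡0 (≤-trans (rank<count f z fz) c≤1)

unique⇒count≤1 : ∀ {m} (f : Fin m → Bool) →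
  (∀ x y → f x ≡ true → f y ≡ true → x ≡ y) → count f ≤ 1
unique⇒count≤1 f unique = ≮⇒≥ λ 1<c →
  let x , fx , r₀ = rank-surjective f 0 (≤-<-trans z≤n 1<c)
      y , fy , r₁ = rank-surjective f 1 1<c
  in  0≢1+n (trans (sym r₀) (trans (cong (rank f) (unique x y fx fy)) r₁))

layer : ∀ {m} → (Fin m → Bool) → ℕ → Fin m → Bool
layer f k x = f x ∧ (rank f x ≡ᵇ k)

layer⁺ : ∀ {m} (f : Fin m → Bool) {k x} → f x ≡ true → rank f x ≡ k → layer f k x ≡ true
layer⁺ f {x = x} fx refl rewrite fx = Equivalence.to T-≡ (≡⇒≡ᵇ (rank f x) _ refl)

layer⁻ : ∀ {m} (f : Fin m → Bool) {k x} → layer f k x ≡ true → f x ≡ true × rank f x ≡ k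
layer⁻ f {k} {x} l with f x
... | true = refl , ≡ᵇ⇒≡ (rank f x) k (Equivalence.from T-≡ l)

count-layer≤1 : ∀ {m} (f : Fin m → Bool) k → count (layer f k) ≤ 1
count-layer≤1 f k = unique⇒count≤1 (layer f k) λ x y lx ly →
  let fx , rx = layer⁻ f lx ; fy , ry = layer⁻ f ly
  in  rank-injective f x y fx fy (trans rx (sym ry))

layer-nonempty : ∀ {m} (f : Fin m → Bool) {k} → k < count f → ∃ λ x → layer f k x ≡ true
layer-nonempty f k<count with x , fx , r ← rank-surjective f _ k<count = x , layer⁺ f fx r

module _ {m n : ℕ} (S : EdgeSet m n) where

  column : Fin n → Fin m → Bool
  column b a = S a b

  degA≡count : ∀ a → degA S a ≡ count (S a)
  degA≡count a = sum-allFin-indicator (S a)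

  degB≡count : ∀ b → degB S b ≡ count (column b)
  degB≡count b = sum-allFin-indicator (column b)

  degB≤degMax : ∀ b → degB S b ≤ degMax S
  degB≤degMax b = m≤n⇒m≤o⊔n _ (∈⇒≤-foldr-⊔ (∈-map⁺ (degB S) (∈-allFin b)))

  edgeRank : Fin m → Fin n → ℕ
  edgeRank a b = rank (column b) a

  edgeRank<degB : ∀ {a b} → S a b ≡ true → edgeRank a b < degB S b
  edgeRank<degB {a} {b} s =
    subst (edgeRank a b <_) (sym (degB≡count b)) (rank<count (column b) a s)

  edgeRank<degMax : ∀ {a b} → S a b ≡ true → edgeRank a b < degMax S
  edgeRank<degMax {b = b} s = ≤-trans (edgeRank<degB s) (degB≤degMax b)

  layers : ℕ → EdgeSet m n
  layers k a b = layer (column b) k a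

  layers⁺ : ∀ {k a b} → S a b ≡ true → edgeRank a b ≡ k → layers k a b ≡ true
  layers⁺ {b = b} = layer⁺ (column b)

  layers⁻ : ∀ {k a b} → layers k a b ≡ true → S a b ≡ true × edgeRank a b ≡ k
  layers⁻ {b = b} = layer⁻ (column b)

  degB-layers≤1 : ∀ k b → degB (layers k) b ≤ 1
  degB-layers≤1 k b = subst (_≤ 1) (sym (sum-allFin-indicator (layer (column b) k)))
                            (count-layer≤1 (column b) k)

  layers-covers : ∀ {k b} → k < degB S b → InBEnd (layers k) b
  layers-covers {b = b} k<deg = layer-nonempty (column b) (subst (_ <_) (degB≡count b) k<deg)

  partition : Fin (degMax S) → EdgeSet m n
  partition i = layers (toℕ i)

  partition-isPartition : IsPartition S partition
  partition-isPartition =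
      (λ i a b → proj₁ ∘ layers⁻)
    , (λ a b s → fromℕ< (edgeRank<degMax s) , layers⁺ s (sym (toℕ-fromℕ< (edgeRank<degMax s))))
    , (λ i j a b p q → toℕ-injective (trans (sym (proj₂ (layers⁻ p))) (proj₂ (layers⁻ q))))

  Bset-partition⁺ : ∀ {i b} → toℕ i ≤ degB S b → Bset partition i b
  Bset-partition⁺ {i} {b} i≤deg with toℕ i
  ... | zero  = inj₁ refl
  ... | suc k = inj₂ (fromℕ< k<d , cong suc (toℕ-fromℕ< k<d) ,
                      subst (λ l → InBEnd (layers l) b) (sym (toℕ-fromℕ< k<d)) (layers-covers i≤deg))
    where
    k<d : k < degMax S
    k<d = ≤-trans i≤deg (degB≤degMax _)

  module _ (degA≡1 : ∀ a → degA S a ≡ 1) where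

    count≡1 : ∀ a → count (S a) ≡ 1
    count≡1 a = trans (sym (degA≡count a)) (degA≡1 a)

    edge : ∀ a → ∃ λ b → S a b ≡ true
    edge a with b , s , _ ← rank-surjective (S a) 0 (≤-reflexive (sym (count≡1 a))) = b , s

    edge-unique : ∀ {a b b′} → S a b ≡ true → S a b′ ≡ true → b ≡ b′
    edge-unique {a} = count≤1⇒unique (S a) (≤-reflexive (count≡1 a)) _ _

    degA-layers≤1 : ∀ k a → degA (layers k) a ≤ 1
    degA-layers≤1 k a = subst (_≤ 1) (sym (sum-allFin-indicator (layers k a)))
      (unique⇒count≤1 (layers k a) λ b b′ l l′ → edge-unique (proj₁ (layers⁻ l)) (proj₁ (layers⁻ l′)))

    Aset-partition⁺ : ∀ {i a b} → S a b ≡ true → toℕ i ≤ edgeRank a b → Aset partition i a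
    Aset-partition⁺ {i} {a} {b} s i≤r j j<i (b′ , l) with s′ , r ← layers⁻ l =
      <-irrefl refl (begin-strict
        toℕ i          ≤⟨ i≤r ⟩
        edgeRank a b   ≡⟨ cong (edgeRank a) (edge-unique s s′) ⟩
        edgeRank a b′  ≡⟨ r ⟩
        toℕ j          <⟨ j<i ⟩
        toℕ i          ∎)
      where open ≤-Reasoning

    Aset-partition⁻ : ∀ {i a b} → Aset partition i a → S a b ≡ true → toℕ i ≤ edgeRank a b
    Aset-partition⁻ {i} {a} {b} notEarlier s = ≮⇒≥ λ r<i →
      notEarlier j (subst (_< toℕ i) (sym j≡r) r<i) (b , layers⁺ s (sym j≡r))
      where
      j : Fin (degMax S)
      j = fromℕ< (edgeRank<degMax s)
      j≡r : toℕ j ≡ edgeRank a b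
      j≡r = toℕ-fromℕ< (edgeRank<degMax s)

    partition-inside : ∀ i a b → partition i a b ≡ true → Aset partition i a × Bset partition i b
    partition-inside i a b l with s , r ← layers⁻ l =
        Aset-partition⁺ s (≤-reflexive (sym r))
      , Bset-partition⁺ (subst (_≤ _) r (<⇒≤ (edgeRank<degB s)))

    module _ (E : EdgeSet m n) where

      degB<edgeRank⇒DMPath2 : ∀ {a b b′} → S a b′ ≡ true → E a b ≡ true →
        degB S b < edgeRank a b′ → DMPath2 E S
      degB<edgeRank⇒DMPath2 {a} {b} {b′} s e deg<r =
        a , b′ , b , s , e , ¬-not (λ s′ → <-asym (deg<rank (edge-unique s′ s)) (edgeRank<degB s′)) , bound
        where
        deg<rank : b ≡ b′ → degB S b < edgeRank a b
        deg<rank b≡b′ = subst (λ c → degB S b < edgeRank a c) (sym b≡b′) deg<r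
        bound : degB S b + 2 ≤ degB S b′
        bound = subst (_≤ degB S b′) (+-comm 2 (degB S b)) (≤-trans (s≤s deg<r) (edgeRank<degB s))

      partition-maximal : ¬ DMPath2 E S → ∀ i a b → E a b ≡ true → Aset partition i a →
        InAEnd (partition i) a ⊎ InBEnd (partition i) b
      partition-maximal noPath i a b e a∈A with toℕ i <? degB S b
      ... | yes i<deg = inj₂ (layers-covers i<deg)
      ... | no  i≮deg with b′ , s ← edge a with edgeRank a b′ ≟ toℕ i
      ...   | yes r≡i = inj₁ (b′ , layers⁺ s r≡i)
      ...   | no  r≢i = ⊥-elim (noPath (degB<edgeRank⇒DMPath2 s e
                (≤-<-trans (≮⇒≥ i≮deg) (≤∧≢⇒< (Aset-partition⁻ a∈A s) (r≢i ∘ sym)))))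

lemma13 : ∀ {m n : ℕ} (E S : EdgeSet m n) →
    IsSemiMatching E S → ¬ DMPath2 E S →
    Σ (Fin (degMax S) → EdgeSet m n) λ M →
    IsPartition S M ×
    (∀ i → IsMaximalMatchingIn E (Aset M i) (Bset M i) (M i))
lemma13 E S (S⊆E , degA≡1) noPath =
  partition S , partition-isPartition S , λ i →
      (degA-layers≤1 S degA≡1 (toℕ i) , degB-layers≤1 S (toℕ i))
    , (λ a b l → S⊆E a b (proj₁ (layers⁻ S l)) , partition-inside S degA≡1 i a b l)
    , (λ a b e a∈A _ → partition-maximal S degA≡1 E noPath i a b e a∈A)
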